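{- Let $(X,\Delta)$ be an abstract simplicial complex on a finite ground set $X$ with $|X|=n$, and suppose that for every integer $k$ with $1\le k<\operatorname{rk}(\Delta)$, every vertex of the combinatorial atlas $\mathcal{A}(\Delta,k)$ is hyperbolic. Let $U\in\Delta$ and $x\in X\setminus U$ with $U\cup\{x\}\in\Delta$. Then for all distinct $y,z\in X\setminus U$ with $U\cup\{y,z\}\in\Delta$, we have $U\cup\{x,y\}\in\Delta$ or $U\cup\{x,z\}\in\Delta$.
   Context: An abstract simplicial complex is a pair $(X,\Delta)$ with $\Delta\subseteq 2^X$ such that $S\subset T\in\Delta$ implies $S\in\Delta$; elements of $\Delta$ are faces and $\operatorname{rk}(\Delta)$ is the largest cardinality of a face. $X^*$ is the set of finite words over $X$. A word is feasible if no letter repeats and its set of letters lies in $\Delta$; $\mathcal{L}$ is the set of feasible words. For $\beta\in X^*$, $j\ge0$: $\operatorname{Cnt}_j(\beta)=\{\gamma\in X^*:|\gamma|=j,\ \beta\gamma\in\mathcal{L}\}$. $\bar X=X\cup\{\ast\}$ ($\ast$ a new symbol); vectors/matrices are indexed by $\bar X$. For $\alpha\in X^*$ and $m\ge1$, $\mathbf{A}(\alpha,m)$ is the $\bar X\times\bar X$ matrix with $A_{xy}=|\operatorname{Cnt}_{m-1}(\alpha xy)|$ ($x,y\in X$), $A_{x\ast}=A_{\ast x}=|\operatorname{Cnt}_{m-1}(\alpha x)|$ ($x\in X$), $A_{\ast\ast}=|\operatorname{Cnt}_{m-1}(\alpha)|$. The atlas $\mathcal{A}(\Delta,k)$ has vertices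 $(\alpha,m,t)$ with $1\le m\le k-1$, $\alpha\in X^*$, $|\alpha|\le k-1-m$, $t\in[0,1]$, with associated matrix $t\mathbf{A}(\alpha,m+1)+(1-t)\mathbf{A}(\alpha,m)$, and vertices $(\alpha,0,1)$ with $|\alpha|\le k-1$, with associated matrix $\mathbf{A}(\alpha,1)$. A vertex is hyperbolic if its associated matrix $\mathbf{M}$ satisfies $\langle\mathbf{v},\mathbf{M}\mathbf{w}\rangle^2\ge\langle\mathbf{v},\mathbf{M}\mathbf{v}\rangle\langle\mathbf{w},\mathbf{M}\mathbf{w}\rangle$ for all $\mathbf{v},\mathbf{w}\in\mathbb{R}^{\bar X}$ with $\langle\mathbf{w},\mathbf{M}\mathbf{w}\rangle>0$. -}

module Defs where

open import Data.Nat as ℕ using (ℕ; zero; suc)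
open import Data.Bool using (Bool; true; false; _∧_; not)
open import Data.Fin using (Fin; zero; suc; _≟_)
open import Data.Fin.Subset using (Subset; ⁅_⁆; _∪_; _⊆_; ∣_∣; ⊥)
open import Data.List using (List; []; _∷_; _++_; length; filterᵇ; concatMap; map; allFin)
open import Data.Integer using (+_)
open import Data.Rational using (ℚ; _/_; _+_; _*_; _-_; _≤_; _<_; 0ℚ; 1ℚ)
open import Data.Product using (Σ; _×_; _,_)
open import Relation.Binary.PropositionalEquality using (_≡_)
open import Relation.Nullary.Decidable using (⌊_⌋)

IsSimplicialComplex : {n : ℕ} → (Subset n → Bool) → Set
IsSimplicialComplex {n} Δ = (S T : Subset n) → S ⊆ T → Δ T ≡ true → Δ S ≡ true

-- "k < rk(Δ)" : some face has cardinality > k  (rk = max cardinality of a face)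
_<rk_ : {n : ℕ} → ℕ → (Subset n → Bool) → Set
_<rk_ {n} k Δ = Σ (Subset n) λ S → (Δ S ≡ true) × (k ℕ.< ∣ S ∣)

Word : ℕ → Set
Word n = List (Fin n)

letters : {n : ℕ} → Word n → Subset n
letters []       = ⊥
letters (x ∷ xs) = ⁅ x ⁆ ∪ letters xs

elemᵇ : {n : ℕ} → Fin n → Word n → Bool
elemᵇ x []       = false
elemᵇ x (y ∷ ys) = ⌊ x ≟ y ⌋ Data.Bool.∨ elemᵇ x ys

noRepeatᵇ : {n : ℕ} → Word n → Bool
noRepeatᵇ []       = true
noRepeatᵇ (x ∷ xs) = not (elemᵇ x xs) ∧ noRepeatᵇ xs

feasibleᵇ : {n : ℕ} → (Subset n → Bool) → Word n → Bool
feasibleᵇ Δ β = noRepeatᵇ β ∧ Δ (letters β)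

wordsOfLength : (n j : ℕ) → List (Word n)
wordsOfLength n zero    = [] ∷ []
wordsOfLength n (suc j) = concatMap (λ x → map (x ∷_) (wordsOfLength n j)) (allFin n)

cnt : {n : ℕ} → (Subset n → Bool) → Word n → ℕ → ℕ
cnt {n} Δ β j = length (filterᵇ (λ γ → feasibleᵇ Δ (β ++ γ)) (wordsOfLength n j))

-- Matrices indexed by X̄ = X ∪ {∗}, realised as Fin (suc n) with
-- ∗ = zero and x ∈ X as suc x.

Mat : ℕ → Set
Mat n = Fin (suc n) → Fin (suc n) → ℚ

Vecℚ : ℕ → Set
Vecℚ n = Fin (suc n) → ℚ

ℕ→ℚ : ℕ → ℚ
ℕ→ℚ m = (+ m) / 1

A : {n : ℕ} → (Subset n → Bool) → Word n → ℕ → Mat n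
A Δ α m zero    zero    = ℕ→ℚ (cnt Δ α (m ℕ.∸ 1))
A Δ α m zero    (suc x) = ℕ→ℚ (cnt Δ (α ++ (x ∷ [])) (m ℕ.∸ 1))
A Δ α m (suc x) zero    = ℕ→ℚ (cnt Δ (α ++ (x ∷ [])) (m ℕ.∸ 1))
A Δ α m (suc x) (suc y) = ℕ→ℚ (cnt Δ (α ++ (x ∷ y ∷ [])) (m ℕ.∸ 1))

interp : {n : ℕ} → ℚ → Mat n → Mat n → Mat n
interp t M N i j = t * M i j + (1ℚ - t) * N i j

sumℚ : (m : ℕ) → (Fin m → ℚ) → ℚ
sumℚ zero    f = 0ℚ
sumℚ (suc m) f = f zero + sumℚ m (λ i → f (suc i))

form : {n : ℕ} → Vecℚ n → Mat n → Vecℚ n → ℚ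
form {n} v M w = sumℚ (suc n) λ i → sumℚ (suc n) λ j → v i * M i j * w j

Hyperbolic : {n : ℕ} → Mat n → Set
Hyperbolic {n} M = (v w : Vecℚ n) → 0ℚ < form w M w →
  form v M v * form w M w ≤ form v M w * form v M w

AtlasHyperbolic : {n : ℕ} → (Subset n → Bool) → ℕ → Set
AtlasHyperbolic {n} Δ k =
  ((α : Word n) (m : ℕ) (t : ℚ) → 1 ℕ.≤ m → m ℕ.≤ k ℕ.∸ 1 →
     length α ℕ.≤ k ℕ.∸ 1 ℕ.∸ m → 0ℚ ≤ t → t ≤ 1ℚ →
     Hyperbolic (interp t (A Δ α (suc m)) (A Δ α m)))
  × ((α : Word n) → length α ℕ.≤ k ℕ.∸ 1 → Hyperbolic (A Δ α 1))

-- Let α enumerate U and k = |U| + 1. The face U ∪ {y, z} shows k < rk Δ, so the vertex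
-- (α, 0, 1) of 𝒜(Δ, k) is hyperbolic, i.e. M = A(α, 1) is. Every entry of M has the form
-- |Cnt₀(αβ)| ∈ {0, 1}, which records whether the word αβ is feasible.
-- If neither U ∪ {x, y} nor U ∪ {x, z} were a face, M restricted to ∗, x, y, z would be
--   1 1 1 1
--   1 0 0 0
--   1 0 0 1
--   1 0 1 0
-- and for w = e∗, v = e_y + e_z − 2e_x we would get ⟨w,Mw⟩ = 1, ⟨v,Mv⟩ = 2, ⟨v,Mw⟩ = 0,
-- contradicting ⟨v,Mv⟩⟨w,Mw⟩ ≤ ⟨v,Mw⟩².

module Submission where

open import Defs
open import Data.Nat using (ℕ; zero; suc; _≤_; _<_; s≤s; z≤n)
open import Data.Nat.Properties using (≤-reflexive; ≤-<-trans)
open import Data.Bool using (Bool; true; false; _∧_; _∨_; not; if_then_else_)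
open import Data.Bool.Properties using (∨-identityʳ; ∨-assoc; ∧-assoc; ∧-identityʳ; ∧-zeroʳ)
open import Data.Fin using (Fin; zero; suc; _≟_)
open import Data.Fin.Subset using (Subset; _∈_; _∉_; _∪_; _⊆_; ⁅_⁆; ∣_∣)
open import Data.Fin.Subset.Properties
  using (∉⊥; x∈⁅x⁆; x∈⁅y⁆⇒x≡y; p⊆p∪q; x∈p∪q⁺; x∈p∪q⁻; ∪-assoc; ∪-comm; ∪-identityˡ; ∪-identityʳ; p⊂q⇒∣p∣<∣q∣)
open import Data.List using (List; []; _∷_; _++_; length; map)
open import Data.List.Properties using (++-identityʳ; length-map)
open import Data.List.Relation.Unary.All using (All; []; _∷_)
open import Data.Vec using ([]; _∷_)
open import Data.Product using (_×_; _,_; proj₂)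
open import Data.Rational using (ℚ; _+_; _*_; -_; 0ℚ; 1ℚ) renaming (_<_ to _<ℚ_; _≤_ to _≤ℚ_)
open import Data.Rational.Properties
  using (+-identityˡ; +-identityʳ; *-zeroˡ; *-zeroʳ; *-identityˡ; *-distribˡ-+; *-assoc; *-comm; _≤?_; _<?_)
open import Data.Rational.Solver using (module +-*-Solver)
open import Data.Sum using (_⊎_; inj₁; inj₂)
open import Data.Empty using (⊥; ⊥-elim)
open import Function using (_∘_)
open import Relation.Binary.PropositionalEquality
  using (_≡_; _≢_; refl; sym; trans; cong; cong₂; subst; subst₂; module ≡-Reasoning)
open import Relation.Nullary using (¬_; yes; no; contradiction)
open import Relation.Nullary.Decidable using (⌊_⌋; isYes≗does; from-yes; from-no; dec-true; dec-false)
open +-*-Solver using (solve; _:+_; _:*_; _:=_)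

unit : ∀ {m} → Fin m → Fin m → ℚ
unit zero    zero    = 1ℚ
unit zero    (suc _) = 0ℚ
unit (suc _) zero    = 0ℚ
unit (suc p) (suc i) = unit p i

Combination : ℕ → Set
Combination m = List (Fin m × ℚ)

⟦_⟧ : ∀ {m} → Combination m → Fin m → ℚ
⟦ [] ⟧          i = 0ℚ
⟦ (p , a) ∷ L ⟧ i = a * unit p i + ⟦ L ⟧ i

dot : ∀ {m} → Combination m → (Fin m → ℚ) → ℚ
dot []            h = 0ℚ
dot ((p , a) ∷ L) h = a * h p + dot L h

sumℚ-cong : ∀ m {f g : Fin m → ℚ} → (∀ i → f i ≡ g i) → sumℚ m f ≡ sumℚ m g
sumℚ-cong zero    f≡g = refl
sumℚ-cong (suc m) f≡g = cong₂ _+_ (f≡g zero) (sumℚ-cong m (λ i → f≡g (suc i)))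

sumℚ-zero : ∀ m → sumℚ m (λ _ → 0ℚ) ≡ 0ℚ
sumℚ-zero zero    = refl
sumℚ-zero (suc m) = trans (+-identityˡ _) (sumℚ-zero m)

sumℚ-+ : ∀ m (f g : Fin m → ℚ) → sumℚ m (λ i → f i + g i) ≡ sumℚ m f + sumℚ m g
sumℚ-+ zero    f g = sym (+-identityˡ 0ℚ)
sumℚ-+ (suc m) f g = trans (cong (f zero + g zero +_) (sumℚ-+ m _ _))
  (solve 4 (λ a b c d → (a :+ b) :+ (c :+ d) := (a :+ c) :+ (b :+ d)) refl
    (f zero) (g zero) (sumℚ m (λ i → f (suc i))) (sumℚ m (λ i → g (suc i))))

sumℚ-*ˡ : ∀ m c (f : Fin m → ℚ) → sumℚ m (λ i → c * f i) ≡ c * sumℚ m f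
sumℚ-*ˡ zero    c f = sym (*-zeroʳ c)
sumℚ-*ˡ (suc m) c f = trans (cong (c * f zero +_) (sumℚ-*ˡ m c _))
  (sym (*-distribˡ-+ c (f zero) _))

sumℚ-unit : ∀ m (p : Fin m) (h : Fin m → ℚ) → sumℚ m (λ i → unit p i * h i) ≡ h p
sumℚ-unit (suc m) zero h = begin
  1ℚ * h zero + sumℚ m (λ i → 0ℚ * h (suc i))
    ≡⟨ cong₂ _+_ (*-identityˡ (h zero)) (sumℚ-cong m (λ i → *-zeroˡ (h (suc i)))) ⟩
  h zero + sumℚ m (λ _ → 0ℚ) ≡⟨ cong (h zero +_) (sumℚ-zero m) ⟩
  h zero + 0ℚ                ≡⟨ +-identityʳ _ ⟩
  h zero                     ∎
  where open ≡-Reasoning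
sumℚ-unit (suc m) (suc p) h =
  trans (cong₂ _+_ (*-zeroˡ (h zero)) (sumℚ-unit m p (λ i → h (suc i)))) (+-identityˡ _)

sumℚ-⟦⟧ : ∀ m (L : Combination m) (h : Fin m → ℚ) → sumℚ m (λ i → ⟦ L ⟧ i * h i) ≡ dot L h
sumℚ-⟦⟧ m []            h = trans (sumℚ-cong m (λ i → *-zeroˡ (h i))) (sumℚ-zero m)
sumℚ-⟦⟧ m ((p , a) ∷ L) h = begin
  sumℚ m (λ i → (a * unit p i + ⟦ L ⟧ i) * h i)
    ≡⟨ sumℚ-cong m (λ i → solve 4 (λ a e v hi → (a :* e :+ v) :* hi := a :* (e :* hi) :+ v :* hi)
                             refl a (unit p i) (⟦ L ⟧ i) (h i)) ⟩
  sumℚ m (λ i → a * (unit p i * h i) + ⟦ L ⟧ i * h i)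
    ≡⟨ sumℚ-+ m _ _ ⟩
  sumℚ m (λ i → a * (unit p i * h i)) + sumℚ m (λ i → ⟦ L ⟧ i * h i)
    ≡⟨ cong₂ _+_ (trans (sumℚ-*ˡ m a _) (cong (a *_) (sumℚ-unit m p h))) (sumℚ-⟦⟧ m L h) ⟩
  a * h p + dot L h ∎
  where open ≡-Reasoning

form-⟦⟧ : ∀ {n} (L L′ : Combination (suc n)) (M : Mat n) →
  form ⟦ L ⟧ M ⟦ L′ ⟧ ≡ dot L (λ p → dot L′ (M p))
form-⟦⟧ {n} L L′ M = begin
  sumℚ (suc n) (λ i → sumℚ (suc n) (λ j → ⟦ L ⟧ i * M i j * ⟦ L′ ⟧ j))
    ≡⟨ sumℚ-cong (suc n) row ⟩
  sumℚ (suc n) (λ i → ⟦ L ⟧ i * dot L′ (M i))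
    ≡⟨ sumℚ-⟦⟧ (suc n) L _ ⟩
  dot L (λ p → dot L′ (M p)) ∎
  where
  open ≡-Reasoning
  row : ∀ i → sumℚ (suc n) (λ j → ⟦ L ⟧ i * M i j * ⟦ L′ ⟧ j) ≡ ⟦ L ⟧ i * dot L′ (M i)
  row i = begin
    sumℚ (suc n) (λ j → ⟦ L ⟧ i * M i j * ⟦ L′ ⟧ j)
      ≡⟨ sumℚ-cong (suc n) (λ j → *-assoc (⟦ L ⟧ i) (M i j) (⟦ L′ ⟧ j)) ⟩
    sumℚ (suc n) (λ j → ⟦ L ⟧ i * (M i j * ⟦ L′ ⟧ j))
      ≡⟨ sumℚ-*ˡ (suc n) (⟦ L ⟧ i) (λ j → M i j * ⟦ L′ ⟧ j) ⟩
    ⟦ L ⟧ i * sumℚ (suc n) (λ j → M i j * ⟦ L′ ⟧ j)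
      ≡⟨ cong (⟦ L ⟧ i *_) (sumℚ-cong (suc n) (λ j → *-comm (M i j) (⟦ L′ ⟧ j))) ⟩
    ⟦ L ⟧ i * sumℚ (suc n) (λ j → ⟦ L′ ⟧ j * M i j)
      ≡⟨ cong (⟦ L ⟧ i *_) (sumℚ-⟦⟧ (suc n) L′ (M i)) ⟩
    ⟦ L ⟧ i * dot L′ (M i) ∎

pattern-not-hyperbolic : ∀ {n} (M : Mat n) (x y z : Fin n) →
  M zero zero ≡ 1ℚ → M (suc x) zero ≡ 1ℚ → M (suc y) zero ≡ 1ℚ → M (suc z) zero ≡ 1ℚ →
  M (suc x) (suc x) ≡ 0ℚ → M (suc x) (suc y) ≡ 0ℚ → M (suc x) (suc z) ≡ 0ℚ →
  M (suc y) (suc x) ≡ 0ℚ → M (suc y) (suc y) ≡ 0ℚ → M (suc y) (suc z) ≡ 1ℚ →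
  M (suc z) (suc x) ≡ 0ℚ → M (suc z) (suc y) ≡ 1ℚ → M (suc z) (suc z) ≡ 0ℚ →
  ¬ Hyperbolic M
pattern-not-hyperbolic {n} M x y z m∗∗ mx∗ my∗ mz∗ mxx mxy mxz myx myy myz mzx mzy mzz hyperbolic =
  from-no ((1ℚ + 1ℚ) * 1ℚ ≤? 0ℚ * 0ℚ)
    (subst₂ _≤ℚ_ (cong₂ _*_ vv ww) (cong₂ _*_ vw vw)
      (hyperbolic ⟦ v ⟧ ⟦ w ⟧ (subst (0ℚ <ℚ_) (sym ww) (from-yes (0ℚ <? 1ℚ)))))
  where
  v w : Combination (suc n)
  v = (suc y , 1ℚ) ∷ (suc z , 1ℚ) ∷ (suc x , - (1ℚ + 1ℚ)) ∷ []
  w = (zero , 1ℚ) ∷ []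
  vv : form ⟦ v ⟧ M ⟦ v ⟧ ≡ 1ℚ + 1ℚ
  vv = trans (form-⟦⟧ v v M) entries
    where
    entries : dot v (λ p → dot v (M p)) ≡ 1ℚ + 1ℚ
    entries rewrite myy | myz | myx | mzy | mzz | mzx | mxy | mxz | mxx = refl
  vw : form ⟦ v ⟧ M ⟦ w ⟧ ≡ 0ℚ
  vw = trans (form-⟦⟧ v w M) entries
    where
    entries : dot v (λ p → dot w (M p)) ≡ 0ℚ
    entries rewrite my∗ | mz∗ | mx∗ = refl
  ww : form ⟦ w ⟧ M ⟦ w ⟧ ≡ 1ℚ
  ww = trans (form-⟦⟧ w w M) entries
    where
    entries : dot w (λ p → dot w (M p)) ≡ 1ℚ
    entries rewrite m∗∗ = refl

enumerate : ∀ {n} → Subset n → Word n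
enumerate []          = []
enumerate (true ∷ p)  = zero ∷ map suc (enumerate p)
enumerate (false ∷ p) = map suc (enumerate p)

letters-map-suc : ∀ {n} (w : Word n) → letters (map suc w) ≡ false ∷ letters w
letters-map-suc []      = refl
letters-map-suc (a ∷ w) = cong (⁅ suc a ⁆ ∪_) (letters-map-suc w)

letters-enumerate : ∀ {n} (p : Subset n) → letters (enumerate p) ≡ p
letters-enumerate []          = refl
letters-enumerate (true ∷ p)  =
  trans (cong (⁅ zero ⁆ ∪_) (letters-map-suc (enumerate p)))
        (cong (true ∷_) (trans (∪-identityˡ _) (letters-enumerate p)))
letters-enumerate (false ∷ p) =
  trans (letters-map-suc (enumerate p)) (cong (false ∷_) (letters-enumerate p))

elemᵇ-map-suc : ∀ {n} (c : Fin n) (w : Word n) → elemᵇ (suc c) (map suc w) ≡ elemᵇ c w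
elemᵇ-map-suc c []      = refl
elemᵇ-map-suc c (a ∷ w) with c ≟ a
... | yes _ = refl
... | no  _ = elemᵇ-map-suc c w

elemᵇ-zero-map-suc : ∀ {n} (w : Word n) → elemᵇ zero (map suc w) ≡ false
elemᵇ-zero-map-suc []      = refl
elemᵇ-zero-map-suc (a ∷ w) = elemᵇ-zero-map-suc w

noRepeatᵇ-map-suc : ∀ {n} (w : Word n) → noRepeatᵇ (map suc w) ≡ noRepeatᵇ w
noRepeatᵇ-map-suc []      = refl
noRepeatᵇ-map-suc (a ∷ w) = cong₂ (λ b r → not b ∧ r) (elemᵇ-map-suc a w) (noRepeatᵇ-map-suc w)

noRepeatᵇ-enumerate : ∀ {n} (p : Subset n) → noRepeatᵇ (enumerate p) ≡ true
noRepeatᵇ-enumerate []          = refl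
noRepeatᵇ-enumerate (true ∷ p)  =
  cong₂ (λ b r → not b ∧ r) (elemᵇ-zero-map-suc (enumerate p))
        (trans (noRepeatᵇ-map-suc (enumerate p)) (noRepeatᵇ-enumerate p))
noRepeatᵇ-enumerate (false ∷ p) = trans (noRepeatᵇ-map-suc (enumerate p)) (noRepeatᵇ-enumerate p)

length-enumerate : ∀ {n} (p : Subset n) → length (enumerate p) ≡ ∣ p ∣
length-enumerate []          = refl
length-enumerate (true ∷ p)  = cong suc (trans (length-map suc (enumerate p)) (length-enumerate p))
length-enumerate (false ∷ p) = trans (length-map suc (enumerate p)) (length-enumerate p)

letters-++ : ∀ {n} (α γ : Word n) → letters (α ++ γ) ≡ letters α ∪ letters γ
letters-++ []      γ = sym (∪-identityˡ (letters γ))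
letters-++ (a ∷ α) γ =
  trans (cong (⁅ a ⁆ ∪_) (letters-++ α γ)) (sym (∪-assoc ⁅ a ⁆ (letters α) (letters γ)))

elemᵇ-++ : ∀ {n} (c : Fin n) (α γ : Word n) → elemᵇ c (α ++ γ) ≡ elemᵇ c α ∨ elemᵇ c γ
elemᵇ-++ c []      γ = refl
elemᵇ-++ c (a ∷ α) γ =
  trans (cong (⌊ c ≟ a ⌋ ∨_) (elemᵇ-++ c α γ)) (sym (∨-assoc ⌊ c ≟ a ⌋ (elemᵇ c α) (elemᵇ c γ)))

∉letters⇒elemᵇ≡false : ∀ {n} {c : Fin n} (w : Word n) → c ∉ letters w → elemᵇ c w ≡ false
∉letters⇒elemᵇ≡false         []      c∉w = refl
∉letters⇒elemᵇ≡false {c = c} (a ∷ w) c∉w with c ≟ a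
... | yes refl = contradiction (x∈p∪q⁺ (inj₁ (x∈⁅x⁆ c))) c∉w
... | no  _    = ∉letters⇒elemᵇ≡false w (λ c∈w → c∉w (x∈p∪q⁺ (inj₂ c∈w)))

noRepeatᵇ-++ : ∀ {n} (α γ : Word n) → (∀ c → c ∈ letters α → c ∉ letters γ) →
  noRepeatᵇ (α ++ γ) ≡ noRepeatᵇ α ∧ noRepeatᵇ γ
noRepeatᵇ-++ []      γ disjoint = refl
noRepeatᵇ-++ (a ∷ α) γ disjoint = begin
  not (elemᵇ a (α ++ γ)) ∧ noRepeatᵇ (α ++ γ)
    ≡⟨ cong₂ (λ b r → not b ∧ r) a∉α++γ (noRepeatᵇ-++ α γ (λ c c∈α → disjoint c (x∈p∪q⁺ (inj₂ c∈α)))) ⟩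
  not (elemᵇ a α) ∧ (noRepeatᵇ α ∧ noRepeatᵇ γ)
    ≡⟨ sym (∧-assoc (not (elemᵇ a α)) (noRepeatᵇ α) (noRepeatᵇ γ)) ⟩
  (not (elemᵇ a α) ∧ noRepeatᵇ α) ∧ noRepeatᵇ γ ∎
  where
  open ≡-Reasoning
  a∉α++γ : elemᵇ a (α ++ γ) ≡ elemᵇ a α
  a∉α++γ = begin
    elemᵇ a (α ++ γ)      ≡⟨ elemᵇ-++ a α γ ⟩
    elemᵇ a α ∨ elemᵇ a γ ≡⟨ cong (elemᵇ a α ∨_) (∉letters⇒elemᵇ≡false γ (disjoint a (x∈p∪q⁺ (inj₁ (x∈⁅x⁆ a))))) ⟩
    elemᵇ a α ∨ false     ≡⟨ ∨-identityʳ (elemᵇ a α) ⟩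
    elemᵇ a α             ∎

All∉⇒∉letters : ∀ {n} {p : Subset n} {c : Fin n} (γ : Word n) →
  All (_∉ p) γ → c ∈ p → c ∉ letters γ
All∉⇒∉letters []      []           c∈p c∈γ = ∉⊥ c∈γ
All∉⇒∉letters (a ∷ γ) (a∉p ∷ γ∉p) c∈p c∈aγ with x∈p∪q⁻ ⁅ a ⁆ (letters γ) c∈aγ
... | inj₁ c∈a = a∉p (subst (_∈ _) (x∈⁅y⁆⇒x≡y a c∈a) c∈p)
... | inj₂ c∈γ = All∉⇒∉letters γ γ∉p c∈p c∈γ

feasibleᵇ-enumerate-++ : ∀ {n} (Δ : Subset n → Bool) (U : Subset n) (γ : Word n) →
  All (_∉ U) γ →
  feasibleᵇ Δ (enumerate U ++ γ) ≡ noRepeatᵇ γ ∧ Δ (U ∪ letters γ)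
feasibleᵇ-enumerate-++ Δ U γ γ∉U = cong₂ _∧_ noRepeat face
  where
  open ≡-Reasoning
  noRepeat : noRepeatᵇ (enumerate U ++ γ) ≡ noRepeatᵇ γ
  noRepeat = begin
    noRepeatᵇ (enumerate U ++ γ)
      ≡⟨ noRepeatᵇ-++ (enumerate U) γ
           (λ c c∈U → All∉⇒∉letters γ γ∉U (subst (c ∈_) (letters-enumerate U) c∈U)) ⟩
    noRepeatᵇ (enumerate U) ∧ noRepeatᵇ γ
      ≡⟨ cong (_∧ noRepeatᵇ γ) (noRepeatᵇ-enumerate U) ⟩
    noRepeatᵇ γ ∎
  face : Δ (letters (enumerate U ++ γ)) ≡ Δ (U ∪ letters γ)
  face = cong Δ (trans (letters-++ (enumerate U) γ) (cong (_∪ letters γ) (letters-enumerate U)))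

𝟙 : Bool → ℕ
𝟙 b = if b then 1 else 0

cnt-zero : ∀ {n} (Δ : Subset n → Bool) (β : Word n) → cnt Δ β 0 ≡ 𝟙 (feasibleᵇ Δ β)
cnt-zero Δ β rewrite ++-identityʳ β with feasibleᵇ Δ β
... | true  = refl
... | false = refl

¬false×false⇒true⊎true : ∀ a b → (a ≡ false → b ≡ false → ⊥) → a ≡ true ⊎ b ≡ true
¬false×false⇒true⊎true true  _     _ = inj₁ refl
¬false×false⇒true⊎true false true  _ = inj₂ refl
¬false×false⇒true⊎true false false f = ⊥-elim (f refl refl)

∣p∣<∣p∪⁅x⁆∣ : ∀ {n} {p : Subset n} {x} → x ∉ p → ∣ p ∣ < ∣ p ∪ ⁅ x ⁆ ∣
∣p∣<∣p∪⁅x⁆∣ {x = x} x∉p = p⊂q⇒∣p∣<∣q∣ (p⊆p∪q ⁅ x ⁆ , x , x∈p∪q⁺ (inj₂ (x∈⁅x⁆ x)) , x∉p)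

suc∣p∣<∣p∪⁅x⁆∪⁅y⁆∣ : ∀ {n} {p : Subset n} {x y} → x ∉ p → y ∉ p → x ≢ y →
  suc ∣ p ∣ < ∣ p ∪ (⁅ x ⁆ ∪ ⁅ y ⁆) ∣
suc∣p∣<∣p∪⁅x⁆∪⁅y⁆∣ {p = p} {x} {y} x∉p y∉p x≢y =
  subst (λ q → suc ∣ p ∣ < ∣ q ∣) (∪-assoc p ⁅ x ⁆ ⁅ y ⁆)
    (≤-<-trans (∣p∣<∣p∪⁅x⁆∣ x∉p) (∣p∣<∣p∪⁅x⁆∣ y∉p∪⁅x⁆))
  where
  y∉p∪⁅x⁆ : y ∉ p ∪ ⁅ x ⁆
  y∉p∪⁅x⁆ y∈ with x∈p∪q⁻ p ⁅ x ⁆ y∈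
  ... | inj₁ y∈p = y∉p y∈p
  ... | inj₂ y∈x = x≢y (sym (x∈⁅y⁆⇒x≡y x y∈x))

subface-∪ : ∀ {n} {Δ : Subset n → Bool} {p q r : Subset n} → IsSimplicialComplex Δ →
  Δ (p ∪ (q ∪ r)) ≡ true → Δ (p ∪ q) ≡ true
subface-∪ {p = p} {q} {r} closed = closed (p ∪ q) _ (subst (p ∪ q ⊆_) (∪-assoc p q r) (p⊆p∪q r))

module _ {n} (Δ : Subset n → Bool) (U : Subset n) where

  private
    A₁ : Mat n
    A₁ = A Δ (enumerate U) 1

  A₁-∗∗ : A₁ zero zero ≡ ℕ→ℚ (𝟙 (Δ U))
  A₁-∗∗ = cong ℕ→ℚ (trans (cnt-zero Δ (enumerate U))
    (cong 𝟙 (cong₂ _∧_ (noRepeatᵇ-enumerate U) (cong Δ (letters-enumerate U)))))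

  A₁-x∗ : ∀ {a} → a ∉ U → A₁ (suc a) zero ≡ ℕ→ℚ (𝟙 (Δ (U ∪ ⁅ a ⁆)))
  A₁-x∗ {a} a∉U = cong ℕ→ℚ (trans (cnt-zero Δ (enumerate U ++ a ∷ []))
    (cong 𝟙 (trans (feasibleᵇ-enumerate-++ Δ U (a ∷ []) (a∉U ∷ []))
                   (cong (λ s → Δ (U ∪ s)) (∪-identityʳ ⁅ a ⁆)))))

  A₁-xy : ∀ {a b} → a ∉ U → b ∉ U →
    A₁ (suc a) (suc b) ≡ ℕ→ℚ (𝟙 (not ⌊ a ≟ b ⌋ ∧ Δ (U ∪ (⁅ a ⁆ ∪ ⁅ b ⁆))))
  A₁-xy {a} {b} a∉U b∉U = cong ℕ→ℚ (trans (cnt-zero Δ (enumerate U ++ a ∷ b ∷ []))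
    (cong 𝟙 (trans (feasibleᵇ-enumerate-++ Δ U (a ∷ b ∷ []) (a∉U ∷ b∉U ∷ []))
      (cong₂ _∧_ (trans (∧-identityʳ _) (cong not (∨-identityʳ ⌊ a ≟ b ⌋)))
                 (cong (λ s → Δ (U ∪ (⁅ a ⁆ ∪ s))) (∪-identityʳ ⁅ b ⁆))))))

  A₁-xx : ∀ {a} → a ∉ U → A₁ (suc a) (suc a) ≡ 0ℚ
  A₁-xx {a} a∉U = trans (A₁-xy a∉U a∉U)
    (cong (λ d → ℕ→ℚ (𝟙 (not d ∧ Δ (U ∪ (⁅ a ⁆ ∪ ⁅ a ⁆)))))
          (trans (isYes≗does (a ≟ a)) (dec-true (a ≟ a) refl)))

  A₁-xy-face : ∀ {a b} → a ∉ U → b ∉ U → a ≢ b → Δ (U ∪ (⁅ a ⁆ ∪ ⁅ b ⁆)) ≡ true →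
    A₁ (suc a) (suc b) ≡ 1ℚ
  A₁-xy-face {a} {b} a∉U b∉U a≢b face =
    trans (A₁-xy a∉U b∉U) (cong₂ (λ d f → ℕ→ℚ (𝟙 (not d ∧ f)))
      (trans (isYes≗does (a ≟ b)) (dec-false (a ≟ b) a≢b)) face)

  A₁-xy-nonface : ∀ {a b} → a ∉ U → b ∉ U → Δ (U ∪ (⁅ a ⁆ ∪ ⁅ b ⁆)) ≡ false →
    A₁ (suc a) (suc b) ≡ 0ℚ
  A₁-xy-nonface {a} {b} a∉U b∉U nonface =
    trans (A₁-xy a∉U b∉U) (cong (ℕ→ℚ ∘ 𝟙) (trans (cong (not ⌊ a ≟ b ⌋ ∧_) nonface) (∧-zeroʳ _)))

  nonfaces-not-hyperbolic : IsSimplicialComplex Δ → (x y z : Fin n) →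
    Δ U ≡ true → x ∉ U → Δ (U ∪ ⁅ x ⁆) ≡ true →
    y ≢ z → y ∉ U → z ∉ U → Δ (U ∪ (⁅ y ⁆ ∪ ⁅ z ⁆)) ≡ true →
    Δ (U ∪ (⁅ x ⁆ ∪ ⁅ y ⁆)) ≡ false → Δ (U ∪ (⁅ x ⁆ ∪ ⁅ z ⁆)) ≡ false →
    ¬ Hyperbolic A₁
  nonfaces-not-hyperbolic closed x y z ΔU x∉U ΔUx y≢z y∉U z∉U ΔUyz ΔUxy ΔUxz =
    pattern-not-hyperbolic A₁ x y z
      (trans A₁-∗∗ (cong (ℕ→ℚ ∘ 𝟙) ΔU))
      (trans (A₁-x∗ x∉U) (cong (ℕ→ℚ ∘ 𝟙) ΔUx))
      (trans (A₁-x∗ y∉U) (cong (ℕ→ℚ ∘ 𝟙) (subface-∪ closed ΔUyz)))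
      (trans (A₁-x∗ z∉U) (cong (ℕ→ℚ ∘ 𝟙) (subface-∪ closed (trans (swap z y) ΔUyz))))
      (A₁-xx x∉U) (A₁-xy-nonface x∉U y∉U ΔUxy) (A₁-xy-nonface x∉U z∉U ΔUxz)
      (A₁-xy-nonface y∉U x∉U (trans (swap y x) ΔUxy)) (A₁-xx y∉U)
      (A₁-xy-face y∉U z∉U y≢z ΔUyz)
      (A₁-xy-nonface z∉U x∉U (trans (swap z x) ΔUxz))
      (A₁-xy-face z∉U y∉U (y≢z ∘ sym) (trans (swap z y) ΔUyz)) (A₁-xx z∉U)
    where
    swap : ∀ a b → Δ (U ∪ (⁅ a ⁆ ∪ ⁅ b ⁆)) ≡ Δ (U ∪ (⁅ b ⁆ ∪ ⁅ a ⁆))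
    swap a b = cong (λ s → Δ (U ∪ s)) (∪-comm ⁅ a ⁆ ⁅ b ⁆)

lemma4p10 : (n : ℕ) (Δ : Subset n → Bool) → IsSimplicialComplex Δ →
    ((k : ℕ) → 1 ≤ k → k <rk Δ → AtlasHyperbolic Δ k) →
    (U : Subset n) (x : Fin n) → Δ U ≡ true → x ∉ U → Δ (U ∪ ⁅ x ⁆) ≡ true →
    (y z : Fin n) → ¬ (y ≡ z) → y ∉ U → z ∉ U → Δ (U ∪ (⁅ y ⁆ ∪ ⁅ z ⁆)) ≡ true →
    (Δ (U ∪ (⁅ x ⁆ ∪ ⁅ y ⁆)) ≡ true) ⊎ (Δ (U ∪ (⁅ x ⁆ ∪ ⁅ z ⁆)) ≡ true)
lemma4p10 n Δ closed atlas U x ΔU x∉U ΔUx y z y≢z y∉U z∉U ΔUyz =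
  ¬false×false⇒true⊎true _ _ λ ΔUxy ΔUxz →
    nonfaces-not-hyperbolic Δ U closed x y z ΔU x∉U ΔUx y≢z y∉U z∉U ΔUyz ΔUxy ΔUxz hyperbolic
  where
  rank : suc ∣ U ∣ <rk Δ
  rank = U ∪ (⁅ y ⁆ ∪ ⁅ z ⁆) , ΔUyz , suc∣p∣<∣p∪⁅x⁆∪⁅y⁆∣ y∉U z∉U y≢z
  hyperbolic : Hyperbolic (A Δ (enumerate U) 1)
  hyperbolic =
    proj₂ (atlas (suc ∣ U ∣) (s≤s z≤n) rank) (enumerate U) (≤-reflexive (length-enumerate U))
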